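{- Let $T$ be a set-sequential tree with at least 3 vertices, and let $u$ and $v$ be two distinct vertices of $T$ of degree 1. Take 4 disjoint copies $T_1, T_2, T_3, T_4$ of $T$, and for $1 \leq i \leq 4$ let $u_i$ and $v_i$ be the vertices of $T_i$ corresponding to $u$ and $v$ respectively. Let $T'$ be the tree obtained from the disjoint union $T_1 \cup T_2 \cup T_3 \cup T_4$ by adding the three edges $u_1u_2$, $v_2v_3$ and $u_3u_4$. Then $T'$ is set-sequential.
   Context: A graph $G$ is set-sequential if, for some positive integer $m$, there is an assignment of distinct nonzero vectors of $\mathbb{F}_2^m$ to the vertices of $G$ such that, when each edge is labeled with the sum (mod 2) of the labels of its two endpoints, every nonzero vector of $\mathbb{F}_2^m$ occurs exactly once among all vertex labels and edge labels. -}

module Defs where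

open import Data.Nat using (ℕ; zero; suc; _≤_; _*_)
open import Data.Bool using (Bool; true; false; T; _∧_; _∨_; _xor_; if_then_else_)
open import Data.Fin using (Fin; _<_; remQuot; _≟_)
open import Data.Fin.Patterns using (0F; 1F; 2F; 3F)
open import Data.List using (List; []; _∷_; _++_; length; filterᵇ; allFin)
open import Data.List.Relation.Unary.Unique.Propositional using (Unique)
open import Data.Vec using (Vec; zipWith; replicate)
open import Data.Product using (Σ; ∃; _×_; _,_; proj₁; proj₂)
open import Data.Sum using (_⊎_; inj₁; inj₂)
open import Data.Unit using (⊤)
open import Relation.Binary.PropositionalEquality using (_≡_; _≢_)
open import Relation.Nullary using (¬_)
open import Relation.Nullary.Decidable using (⌊_⌋)
open import Function.Definitions using (Injective)

Graph : ℕ → Set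
Graph n = Fin n → Fin n → Bool

module _ {n : ℕ} (G : Graph n) where

  Adj : Fin n → Fin n → Set
  Adj i j = T (G i j)

  IsSimpleGraph : Set
  IsSimpleGraph = (∀ i j → G i j ≡ G j i) × (∀ i → G i i ≡ false)

  data Walk : Fin n → Fin n → Set where
    [] : ∀ {x} → Walk x x
    _∷_ : ∀ {x y z} → Adj x y → Walk y z → Walk x z

  Connected : Set
  Connected = ∀ x y → Walk x y

  Chain : List (Fin n) → Set
  Chain [] = ⊤
  Chain (x ∷ []) = ⊤
  Chain (x ∷ y ∷ r) = Adj x y × Chain (y ∷ r)

  HasCycle : Set
  HasCycle = Σ (Fin n) λ x → Σ (List (Fin n)) λ r →
    (2 ≤ length r) × Unique (x ∷ r) × Chain (x ∷ r ++ x ∷ [])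

  IsTree : Set
  IsTree = IsSimpleGraph × Connected × ¬ HasCycle

  degree : Fin n → ℕ
  degree i = length (filterᵇ (G i) (allFin n))

  -- edges: each undirected edge {i,j} is represented once, with i < j
  Edge : Set
  Edge = Σ (Fin n × Fin n) λ p → (proj₁ p < proj₂ p) × Adj (proj₁ p) (proj₂ p)

  zeroV : ∀ {m} → Vec Bool m
  zeroV = replicate _ false

  _⊕_ : ∀ {m} → Vec Bool m → Vec Bool m → Vec Bool m
  _⊕_ = zipWith _xor_

  label : ∀ {m} → (Fin n → Vec Bool m) → Fin n ⊎ Edge → Vec Bool m
  label f (inj₁ x) = f x
  label f (inj₂ ((i , j) , _)) = f i ⊕ f j

  IsSetSequentialLabelling : ∀ {m} → (Fin n → Vec Bool m) → Set
  IsSetSequentialLabelling {m} f =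
    (∀ x → f x ≢ zeroV) × Injective _≡_ _≡_ f ×
    (∀ (w : Vec Bool m) → w ≢ zeroV →
      Σ (Fin n ⊎ Edge) λ z → label f z ≡ w × (∀ z′ → label f z′ ≡ w → z′ ≡ z))

  SetSequential : Set
  SetSequential = Σ ℕ λ m → suc zero ≤ m × Σ (Fin n → Vec Bool m) IsSetSequentialLabelling

-- The tree T′ built from four copies of T (vertex (k , x) of copy k is
-- encoded as the element of Fin (4 * n) decoded by remQuot n), joined by
-- the edges u₁u₂, v₂v₃, u₃u₄ (copies indexed 0F..3F).
fourCopies : ∀ {n} → Graph n → Fin n → Fin n → Graph (4 * n)
fourCopies {n} G u v a b with remQuot {4} n a | remQuot {4} n b
... | (k , x) | (l , y) =
  (⌊ k ≟ l ⌋ ∧ G x y) ∨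
  bridge k x l y ∨ bridge l y k x
  where
  is : Fin 4 → Fin n → Fin 4 → Fin n → Bool
  is k x k₀ x₀ = ⌊ k ≟ k₀ ⌋ ∧ ⌊ x ≟ x₀ ⌋
  bridge : Fin 4 → Fin n → Fin 4 → Fin n → Bool
  bridge k x l y =
    (is k x 0F u ∧ is l y 1F u) ∨
    (is k x 1F v ∧ is l y 2F v) ∨
    (is k x 2F u ∧ is l y 3F u)

-- Let f be a set-sequential labelling of the tree T in 𝔽₂^m and u, v leaves
-- with neighbours u′, v′.  We label T′ in 𝔽₂^(2+m) = 𝔽₂² × 𝔽₂^m: vertex x of
-- copy k gets high k x ++ low k x.  The low part is f on copies 0, 1 and on
-- copies 2, 3 the twist of f giving u the label f u ⊕ f u′ of its pendant
-- edge, which merely swaps the labels of u and uu′.  The high part, built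
-- from a proper 2-colouring of T, makes the four copies of each item of T
-- carry the four elements of 𝔽₂² above the same low label, while the bridges
-- u₁u₂, v₂v₃, u₃u₄ carry the three nonzero elements of 𝔽₂² above 𝟎.  So
-- every nonzero vector is the label of exactly one vertex or edge of T′.
module Submission where

open import Defs hiding (_⊕_; zeroV)
open import Data.Nat using (ℕ; zero; suc; _+_; _*_; _≤_; _<_; z≤n; s≤s)
open import Data.Nat.Properties
  using (≤-refl; ≤-trans; +-comm; +-identityʳ; +-monoʳ-<; +-cancelˡ-<; m<m+n; m≤n+m; suc-injective)
open import Data.Nat.Tactic.RingSolver using (solve-∀)
open import Data.Bool using (Bool; true; false; T; not; _xor_; _∧_; _∨_)
open import Data.Bool.Properties
  using (xor-comm; xor-assoc; xor-same; xor-identityˡ; xor-identityʳ; not-distribˡ-xor; ¬-not;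
         T-irrelevant; T-∧; T-∨)
open import Data.Fin using (Fin; remQuot; combine; toℕ; punchIn; punchOut) renaming (_<_ to _<ᶠ_)
import Data.Fin.Properties
open import Data.Fin.Properties
  using (remQuot-combine; combine-remQuot; combine-monoˡ-<; toℕ-combine;
         punchInᵢ≢i; punchIn-injective; punchIn-punchOut)
open import Data.Fin.Patterns using (0F; 1F; 2F; 3F)
open import Data.Vec using (Vec; []; _∷_; _++_; zipWith; replicate)
open import Data.Vec.Properties
  using (zipWith-comm; zipWith-assoc; zipWith-identityˡ; zipWith-identityʳ; zipWith-++; ++-injective; ≡-dec)
open import Data.List using (List; []; _∷_; length; filterᵇ; allFin) renaming (_++_ to _++ˡ_)
open import Data.List.Properties using (length-++; ++-assoc)
open import Data.List.Relation.Unary.Any using (here)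
open import Data.List.Relation.Unary.All.Properties using (¬Any⇒All¬)
open import Data.List.Relation.Unary.AllPairs using ([]; _∷_)
open import Data.List.Relation.Unary.Unique.Propositional using (Unique)
open import Data.List.Membership.Propositional using (_∈_)
open import Data.List.Membership.Propositional.Properties using (∈-filter⁺; ∈-filter⁻; ∈-allFin; ∈-∃++)
open import Data.Product using (Σ; _×_; _,_; proj₁; proj₂)
open import Data.Sum using (_⊎_; inj₁; inj₂; [_,_]′)
import Data.Sum.Properties
open import Data.Empty using (⊥-elim)
open import Function using (_∘_; id)
open import Function.Bundles using (module Equivalence)
open Equivalence using (to; from)
open import Relation.Binary.Definitions using (tri<; tri≈; tri>)
open import Relation.Binary.PropositionalEquality
open import Relation.Nullary using (¬_; yes; no)
open import Relation.Nullary.Decidable using (T?; ⌊_⌋; toWitness)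

-- Vectors of 𝔽₂^m under coordinatewise addition.  `Defs` defines the same
-- operations inside its graph-parametrised module; these copies are
-- definitionally equal and do not mention a graph.
infixl 6 _⊕_
_⊕_ : ∀ {m} → Vec Bool m → Vec Bool m → Vec Bool m
_⊕_ = zipWith _xor_

𝟎 : ∀ {m} → Vec Bool m
𝟎 = replicate _ false

⊕-comm : ∀ {m} (a b : Vec Bool m) → a ⊕ b ≡ b ⊕ a
⊕-comm = zipWith-comm xor-comm

⊕-self : ∀ {m} (a : Vec Bool m) → a ⊕ a ≡ 𝟎
⊕-self []      = refl
⊕-self (x ∷ a) = cong₂ _∷_ (xor-same x) (⊕-self a)

⊕-cancelʳ : ∀ {m} (a b : Vec Bool m) → (a ⊕ b) ⊕ b ≡ a
⊕-cancelʳ a b = begin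
  (a ⊕ b) ⊕ b  ≡⟨ zipWith-assoc xor-assoc a b b ⟩
  a ⊕ (b ⊕ b)  ≡⟨ cong (a ⊕_) (⊕-self b) ⟩
  a ⊕ 𝟎        ≡⟨ zipWith-identityʳ xor-identityʳ a ⟩
  a            ∎
  where open ≡-Reasoning

⊕≡𝟎⇒≡ : ∀ {m} (a b : Vec Bool m) → a ⊕ b ≡ 𝟎 → a ≡ b
⊕≡𝟎⇒≡ a b a⊕b≡𝟎 = begin
  a            ≡⟨ sym (⊕-cancelʳ a b) ⟩
  (a ⊕ b) ⊕ b  ≡⟨ cong (_⊕ b) a⊕b≡𝟎 ⟩
  𝟎 ⊕ b        ≡⟨ zipWith-identityˡ xor-identityˡ b ⟩
  b            ∎
  where open ≡-Reasoning

⊕-++ : ∀ {k m} (p p′ : Vec Bool k) (w w′ : Vec Bool m) → (p ++ w) ⊕ (p′ ++ w′) ≡ (p ⊕ p′) ++ (w ⊕ w′)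
⊕-++ p p′ w w′ = zipWith-++ _xor_ p w p′ w′

-- `L` lists every nonzero vector of 𝔽₂^m exactly once.  A labelling is
-- set-sequential precisely when its labels of vertices and edges do this.
record NonzeroBijection {D : Set} {m : ℕ} (L : D → Vec Bool m) : Set where
  field
    nonzero   : ∀ d → L d ≢ 𝟎
    injective : ∀ d d′ → L d ≡ L d′ → d ≡ d′
    onto      : ∀ w → w ≢ 𝟎 → Σ D λ d → L d ≡ w

-- The additive group 𝔽₂² and the bijections Fin 4 → 𝔽₂² used to number
-- the four copies of a vertex or edge: νᵢ k = ρⁱ (binary k), where ρ is
-- the linear map of order 3 sending 01 ↦ 11 ↦ 10 ↦ 01.
𝔽₂² : Set
𝔽₂² = Vec Bool 2

pattern b00 = false ∷ false ∷ []
pattern b01 = false ∷ true ∷ []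
pattern b10 = true ∷ false ∷ []
pattern b11 = true ∷ true ∷ []

data Numbering : Set where
  ν₀ ν₁ ν₂ : Numbering

⟦_⟧ : Numbering → Fin 4 → 𝔽₂²
⟦ ν₀ ⟧ 0F = b00
⟦ ν₀ ⟧ 1F = b01
⟦ ν₀ ⟧ 2F = b10
⟦ ν₀ ⟧ 3F = b11
⟦ ν₁ ⟧ 0F = b00
⟦ ν₁ ⟧ 1F = b11
⟦ ν₁ ⟧ 2F = b01
⟦ ν₁ ⟧ 3F = b10
⟦ ν₂ ⟧ 0F = b00
⟦ ν₂ ⟧ 1F = b10
⟦ ν₂ ⟧ 2F = b11
⟦ ν₂ ⟧ 3F = b01

⟦_⟧⁻¹ : Numbering → 𝔽₂² → Fin 4
⟦ ν₀ ⟧⁻¹ b00 = 0F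
⟦ ν₀ ⟧⁻¹ b01 = 1F
⟦ ν₀ ⟧⁻¹ b10 = 2F
⟦ ν₀ ⟧⁻¹ b11  = 3F
⟦ ν₁ ⟧⁻¹ b00 = 0F
⟦ ν₁ ⟧⁻¹ b11  = 1F
⟦ ν₁ ⟧⁻¹ b01 = 2F
⟦ ν₁ ⟧⁻¹ b10 = 3F
⟦ ν₂ ⟧⁻¹ b00 = 0F
⟦ ν₂ ⟧⁻¹ b10 = 1F
⟦ ν₂ ⟧⁻¹ b11  = 2F
⟦ ν₂ ⟧⁻¹ b01 = 3F

⟦⟧⁻¹∘⟦⟧ : ∀ ν k → ⟦ ν ⟧⁻¹ (⟦ ν ⟧ k) ≡ k
⟦⟧⁻¹∘⟦⟧ ν₀ 0F = refl
⟦⟧⁻¹∘⟦⟧ ν₀ 1F = refl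
⟦⟧⁻¹∘⟦⟧ ν₀ 2F = refl
⟦⟧⁻¹∘⟦⟧ ν₀ 3F = refl
⟦⟧⁻¹∘⟦⟧ ν₁ 0F = refl
⟦⟧⁻¹∘⟦⟧ ν₁ 1F = refl
⟦⟧⁻¹∘⟦⟧ ν₁ 2F = refl
⟦⟧⁻¹∘⟦⟧ ν₁ 3F = refl
⟦⟧⁻¹∘⟦⟧ ν₂ 0F = refl
⟦⟧⁻¹∘⟦⟧ ν₂ 1F = refl
⟦⟧⁻¹∘⟦⟧ ν₂ 2F = refl
⟦⟧⁻¹∘⟦⟧ ν₂ 3F = refl

⟦⟧∘⟦⟧⁻¹ : ∀ ν p → ⟦ ν ⟧ (⟦ ν ⟧⁻¹ p) ≡ p
⟦⟧∘⟦⟧⁻¹ ν₀ b00 = refl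
⟦⟧∘⟦⟧⁻¹ ν₀ b01 = refl
⟦⟧∘⟦⟧⁻¹ ν₀ b10 = refl
⟦⟧∘⟦⟧⁻¹ ν₀ b11  = refl
⟦⟧∘⟦⟧⁻¹ ν₁ b00 = refl
⟦⟧∘⟦⟧⁻¹ ν₁ b01 = refl
⟦⟧∘⟦⟧⁻¹ ν₁ b10 = refl
⟦⟧∘⟦⟧⁻¹ ν₁ b11  = refl
⟦⟧∘⟦⟧⁻¹ ν₂ b00 = refl
⟦⟧∘⟦⟧⁻¹ ν₂ b01 = refl
⟦⟧∘⟦⟧⁻¹ ν₂ b10 = refl
⟦⟧∘⟦⟧⁻¹ ν₂ b11  = refl

⟦⟧-injective : ∀ ν k k′ → ⟦ ν ⟧ k ≡ ⟦ ν ⟧ k′ → k ≡ k′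
⟦⟧-injective ν k k′ eq = begin
  k                     ≡⟨ sym (⟦⟧⁻¹∘⟦⟧ ν k) ⟩
  ⟦ ν ⟧⁻¹ (⟦ ν ⟧ k)     ≡⟨ cong ⟦ ν ⟧⁻¹ eq ⟩
  ⟦ ν ⟧⁻¹ (⟦ ν ⟧ k′)    ≡⟨ ⟦⟧⁻¹∘⟦⟧ ν k′ ⟩
  k′                    ∎
  where open ≡-Reasoning

byColour : Bool → Numbering
byColour false = ν₀
byColour true  = ν₁

-- ν₀ k ⊕ ν₁ k ⊕ ν₂ k = 0 for every k (as 1 + ρ + ρ² = 0), so any two
-- numberings add up to the third; these are the two instances we need
colours-sum : ∀ c k → ⟦ byColour c ⟧ k ⊕ ⟦ byColour (not c) ⟧ k ≡ ⟦ ν₂ ⟧ k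
colours-sum false 0F = refl
colours-sum false 1F = refl
colours-sum false 2F = refl
colours-sum false 3F = refl
colours-sum true  0F = refl
colours-sum true  1F = refl
colours-sum true  2F = refl
colours-sum true  3F = refl

ν₂-shift : ∀ c k → ⟦ ν₂ ⟧ k ⊕ ⟦ byColour c ⟧ k ≡ ⟦ byColour (not c) ⟧ k
ν₂-shift false 0F = refl
ν₂-shift false 1F = refl
ν₂-shift false 2F = refl
ν₂-shift false 3F = refl
ν₂-shift true  0F = refl
ν₂-shift true  1F = refl
ν₂-shift true  2F = refl
ν₂-shift true  3F = refl

-- the three nonzero elements of 𝔽₂², in the order the bridges of T′ carry them
nonzero₂ : Fin 3 → 𝔽₂²
nonzero₂ 0F = b10
nonzero₂ 1F = b01
nonzero₂ 2F = b11

nonzero₂-bijection : NonzeroBijection nonzero₂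
nonzero₂-bijection = record { nonzero = nonzero ; injective = injective ; onto = onto }
  where
  nonzero : ∀ b → nonzero₂ b ≢ 𝟎
  nonzero 0F ()
  nonzero 1F ()
  nonzero 2F ()
  injective : ∀ b b′ → nonzero₂ b ≡ nonzero₂ b′ → b ≡ b′
  injective 0F 0F _ = refl
  injective 1F 1F _ = refl
  injective 2F 2F _ = refl
  injective 0F 1F ()
  injective 0F 2F ()
  injective 1F 0F ()
  injective 1F 2F ()
  injective 2F 0F ()
  injective 2F 1F ()
  onto : ∀ p → p ≢ 𝟎 → Σ (Fin 3) λ b → nonzero₂ b ≡ p
  onto b00 p≢𝟎 = ⊥-elim (p≢𝟎 refl)
  onto b01 _   = 1F , refl
  onto b10 _   = 0F , refl
  onto b11 _   = 2F , refl

-- Stacking: if ℓ enumerates 𝔽₂^m ∖ 0 and γ enumerates 𝔽₂² ∖ 0, then the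
-- four vectors ⟦ π y ⟧ k ++ ℓ y (k : Fin 4) for each y, together with the
-- vectors γ b ++ 𝟎, enumerate 𝔽₂^(2+m) ∖ 0: a vector p ++ w with w ≠ 0 is
-- hit by the y with ℓ y = w, and one with w = 0 by the b with γ b = p.
stack : ∀ {Y B : Set} {m} → (Y → Vec Bool m) → (B → 𝔽₂²) → (Y → Numbering) →
        (Fin 4 × Y) ⊎ B → Vec Bool (2 + m)
stack ℓ γ π (inj₁ (k , y)) = ⟦ π y ⟧ k ++ ℓ y
stack ℓ γ π (inj₂ b)       = γ b ++ 𝟎

stack-bijection : ∀ {Y B : Set} {m} {ℓ : Y → Vec Bool m} {γ : B → 𝔽₂²} →
  NonzeroBijection ℓ → NonzeroBijection γ → (π : Y → Numbering) →
  NonzeroBijection (stack ℓ γ π)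
stack-bijection {Y} {B} {m} {ℓ} {γ} bℓ bγ π =
  record { nonzero = nonzero ; injective = injective ; onto = onto }
  where
  module ℓ = NonzeroBijection bℓ
  module γ = NonzeroBijection bγ
  L = stack ℓ γ π

  nonzero : ∀ d → L d ≢ 𝟎
  nonzero (inj₁ (k , y)) eq = ℓ.nonzero y (proj₂ (++-injective (⟦ π y ⟧ k) 𝟎 eq))
  nonzero (inj₂ b)       eq = γ.nonzero b (proj₁ (++-injective (γ b) 𝟎 eq))

  injective : ∀ d d′ → L d ≡ L d′ → d ≡ d′
  injective (inj₁ (k , y)) (inj₁ (k′ , y′)) eq
    with refl ← ℓ.injective y y′ (proj₂ (++-injective (⟦ π y ⟧ k) _ eq))
    = cong (λ k → inj₁ (k , y)) (⟦⟧-injective (π y) k k′ (proj₁ (++-injective _ _ eq)))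
  injective (inj₁ (k , y)) (inj₂ b) eq = ⊥-elim (ℓ.nonzero y (proj₂ (++-injective (⟦ π y ⟧ k) _ eq)))
  injective (inj₂ b) (inj₁ (k , y)) eq = ⊥-elim (ℓ.nonzero y (sym (proj₂ (++-injective (γ b) _ eq))))
  injective (inj₂ b) (inj₂ b′) eq = cong inj₂ (γ.injective b b′ (proj₁ (++-injective (γ b) _ eq)))

  onto : ∀ w → w ≢ 𝟎 → Σ ((Fin 4 × Y) ⊎ B) λ d → L d ≡ w
  onto (x₀ ∷ x₁ ∷ w) w≢𝟎 with ≡-dec Data.Bool._≟_ w 𝟎
  ... | yes refl =
    let (b , γb≡p) = γ.onto (x₀ ∷ x₁ ∷ []) (λ { refl → w≢𝟎 refl })
    in inj₂ b , cong (_++ 𝟎) γb≡p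
  ... | no w≢𝟎′ =
    let (y , ℓy≡w) = ℓ.onto w w≢𝟎′
    in inj₁ (⟦ π y ⟧⁻¹ (x₀ ∷ x₁ ∷ []) , y) , cong₂ _++_ (⟦⟧∘⟦⟧⁻¹ (π y) _) ℓy≡w

module _ {n : ℕ} (G : Graph n) where

  Item : Set
  Item = Fin n ⊎ Edge G

  edge-≡ : (e e′ : Edge G) → proj₁ e ≡ proj₁ e′ → e ≡ e′
  edge-≡ (p , lt , a) (.p , lt′ , a′) refl =
    cong₂ (λ lt a → p , lt , a) (Data.Fin.Properties.<-irrelevant lt lt′) (T-irrelevant a a′)

  Touches Avoids : Fin n → Edge G → Set
  Touches x ((i , j) , _) = i ≡ x ⊎ j ≡ x
  Avoids  x ((i , j) , _) = i ≢ x × j ≢ x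

  touches? : ∀ x e → Touches x e ⊎ Avoids x e
  touches? x ((i , j) , _) with i Data.Fin.≟ x | j Data.Fin.≟ x
  ... | yes i≡x | _       = inj₁ (inj₁ i≡x)
  ... | no _    | yes j≡x = inj₁ (inj₂ j≡x)
  ... | no i≢x  | no j≢x  = inj₂ (i≢x , j≢x)

  labelling⇒bijection : ∀ {m} {f : Fin n → Vec Bool m} →
    IsSetSequentialLabelling G f → NonzeroBijection (label G f)
  labelling⇒bijection {m} {f} (f≢𝟎 , f-injective , unique) =
    record { nonzero = nonzero ; injective = injective ; onto = onto }
    where
    nonzero : ∀ z → label G f z ≢ 𝟎
    nonzero (inj₁ x) = f≢𝟎 x
    nonzero (inj₂ ((i , j) , i<j , _)) fi⊕fj≡𝟎 =
      Data.Fin.Properties.<⇒≢ i<j (f-injective (⊕≡𝟎⇒≡ (f i) (f j) fi⊕fj≡𝟎))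
    injective : ∀ z z′ → label G f z ≡ label G f z′ → z ≡ z′
    injective z z′ eq = trans (only z refl) (sym (only z′ (sym eq)))
      where only = proj₂ (proj₂ (unique (label G f z) (nonzero z)))
    onto : ∀ w → w ≢ 𝟎 → Σ Item λ z → label G f z ≡ w
    onto w w≢𝟎 = let (z , fz≡w , _) = unique w w≢𝟎 in z , fz≡w

  bijection⇒labelling : ∀ {m} {f : Fin n → Vec Bool m} {D : Set} (enc : D → Item) (L : D → Vec Bool m) →
    (∀ z → Σ D λ d → enc d ≡ z) → (∀ d → label G f (enc d) ≡ L d) → NonzeroBijection L →
    IsSetSequentialLabelling G f
  bijection⇒labelling {m} {f} {D} enc L enc-onto label-enc bij = f≢𝟎 , f-injective , unique
    where
    open NonzeroBijection bij
    index : Item → D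
    index z = proj₁ (enc-onto z)
    enc-index : ∀ z → enc (index z) ≡ z
    enc-index z = proj₂ (enc-onto z)
    label-index : ∀ z → label G f z ≡ L (index z)
    label-index z = trans (cong (label G f) (sym (enc-index z))) (label-enc (index z))

    f≢𝟎 : ∀ x → f x ≢ 𝟎
    f≢𝟎 x = nonzero (index (inj₁ x)) ∘ trans (sym (label-index (inj₁ x)))
    f-injective : ∀ {x y} → f x ≡ f y → x ≡ y
    f-injective {x} {y} eq = Data.Sum.Properties.inj₁-injective (begin
      inj₁ x                ≡⟨ sym (enc-index (inj₁ x)) ⟩
      enc (index (inj₁ x))  ≡⟨ cong enc (injective _ _ same-label) ⟩
      enc (index (inj₁ y))  ≡⟨ enc-index (inj₁ y) ⟩
      inj₁ y                ∎)
      where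
      open ≡-Reasoning
      same-label : L (index (inj₁ x)) ≡ L (index (inj₁ y))
      same-label = trans (sym (label-index (inj₁ x))) (trans eq (label-index (inj₁ y)))
    unique : ∀ w → w ≢ 𝟎 → Σ Item λ z → label G f z ≡ w × (∀ z′ → label G f z′ ≡ w → z′ ≡ z)
    unique w w≢𝟎 = let (d , Ld≡w) = onto w w≢𝟎 in
      enc d , trans (label-enc d) Ld≡w , λ z′ fz′≡w →
        trans (sym (enc-index z′)) (cong enc (injective _ d (trans (sym (label-index z′)) (trans fz′≡w (sym Ld≡w)))))

module SimpleGraph {n : ℕ} {G : Graph n} (simple : IsSimpleGraph G) where

  adj-sym : ∀ {x y} → Adj G x y → Adj G y x
  adj-sym {x} {y} = subst T (proj₁ simple x y)

  adj-irrefl : ∀ {x} → ¬ Adj G x x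
  adj-irrefl {x} = subst T (proj₂ simple x)

-- Its edge to x′
-- (the pendant edge) is the only edge at x, and exchanging the label of x
-- with the label f x ⊕ f x′ of that edge permutes the labels of all items.
module Leaf {n : ℕ} {G : Graph n} (simple : IsSimpleGraph G) {x x′ : Fin n}
  (x~x′ : Adj G x x′) (only : ∀ y → Adj G x y → y ≡ x′) where

  open SimpleGraph simple
  open Data.Fin using (_≟_)

  x′≢x : x′ ≢ x
  x′≢x refl = adj-irrefl x~x′

  touching-ends : ∀ e → Touches G x e → proj₁ e ≡ (x , x′) ⊎ proj₁ e ≡ (x′ , x)
  touching-ends ((i , j) , _ , a) (inj₁ refl) = inj₁ (cong (x ,_) (only j a))
  touching-ends ((i , j) , _ , a) (inj₂ refl) = inj₂ (cong (_, x) (only i (adj-sym a)))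

  label-touching : ∀ {m} (h : Fin n → Vec Bool m) e → Touches G x e → label G h (inj₂ e) ≡ h x ⊕ h x′
  label-touching h e t with touching-ends e t
  ... | inj₁ ends = cong (λ p → h (proj₁ p) ⊕ h (proj₂ p)) ends
  ... | inj₂ ends = trans (cong (λ p → h (proj₁ p) ⊕ h (proj₂ p)) ends) (⊕-comm (h x′) (h x))

  -- and there is only one such edge, since edges list their endpoints in increasing order
  touching-unique : ∀ e e′ → Touches G x e → Touches G x e′ → e ≡ e′
  touching-unique e e′ t t′ with touching-ends e t | touching-ends e′ t′
  ... | inj₁ ends | inj₁ ends′ = edge-≡ G e e′ (trans ends (sym ends′))
  ... | inj₂ ends | inj₂ ends′ = edge-≡ G e e′ (trans ends (sym ends′))
  touching-unique ((_ , _) , i<j , _) ((_ , _) , i′<j′ , _) _ _ | inj₁ refl | inj₂ refl =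
    ⊥-elim (Data.Fin.Properties.<-asym i<j i′<j′)
  touching-unique ((_ , _) , i<j , _) ((_ , _) , i′<j′ , _) _ _ | inj₂ refl | inj₁ refl =
    ⊥-elim (Data.Fin.Properties.<-asym i<j i′<j′)

  pendant : Edge G
  pendant with Data.Fin.Properties.<-cmp x x′
  ... | tri< x<x′ _ _ = (x , x′) , x<x′ , x~x′
  ... | tri≈ _ x≡x′ _ = ⊥-elim (x′≢x (sym x≡x′))
  ... | tri> _ _ x′<x = (x′ , x) , x′<x , adj-sym x~x′

  pendant-touches : Touches G x pendant
  pendant-touches with Data.Fin.Properties.<-cmp x x′
  ... | tri< _ _ _    = inj₁ refl
  ... | tri≈ _ x≡x′ _ = ⊥-elim (x′≢x (sym x≡x′))
  ... | tri> _ _ _    = inj₂ refl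

  swap : Item G → Item G
  swap (inj₁ y) with y ≟ x
  ... | yes _ = inj₂ pendant
  ... | no _  = inj₁ y
  swap (inj₂ e) with touches? G x e
  ... | inj₁ _ = inj₁ x
  ... | inj₂ _ = inj₂ e

  swap-leaf : swap (inj₁ x) ≡ inj₂ pendant
  swap-leaf with x ≟ x
  ... | yes _  = refl
  ... | no x≢x = ⊥-elim (x≢x refl)

  swap-vertex : ∀ y → y ≢ x → swap (inj₁ y) ≡ inj₁ y
  swap-vertex y y≢x with y ≟ x
  ... | yes y≡x = ⊥-elim (y≢x y≡x)
  ... | no _    = refl

  swap-touching : ∀ e → Touches G x e → swap (inj₂ e) ≡ inj₁ x
  swap-touching e t with touches? G x e
  ... | inj₁ _ = refl
  ... | inj₂ (i≢x , j≢x) = ⊥-elim ([ i≢x , j≢x ]′ t)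

  swap-avoiding : ∀ e → Avoids G x e → swap (inj₂ e) ≡ inj₂ e
  swap-avoiding e (i≢x , j≢x) with touches? G x e
  ... | inj₁ t = ⊥-elim ([ i≢x , j≢x ]′ t)
  ... | inj₂ _ = refl

  swap-involutive : ∀ z → swap (swap z) ≡ z
  swap-involutive (inj₁ y) with y ≟ x
  ... | yes refl = swap-touching pendant pendant-touches
  ... | no y≢x   = swap-vertex y y≢x
  swap-involutive (inj₂ e) with touches? G x e
  ... | inj₁ t = trans swap-leaf (cong inj₂ (touching-unique pendant e pendant-touches t))
  ... | inj₂ a = swap-avoiding e a

  twist : ∀ {m} → (Fin n → Vec Bool m) → Fin n → Vec Bool m
  twist f y with y ≟ x
  ... | yes _ = f x ⊕ f x′
  ... | no _  = f y

  twist-leaf : ∀ {m} (f : Fin n → Vec Bool m) → twist f x ≡ f x ⊕ f x′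
  twist-leaf f with x ≟ x
  ... | yes _  = refl
  ... | no x≢x = ⊥-elim (x≢x refl)

  twist-vertex : ∀ {m} (f : Fin n → Vec Bool m) y → y ≢ x → twist f y ≡ f y
  twist-vertex f y y≢x with y ≟ x
  ... | yes y≡x = ⊥-elim (y≢x y≡x)
  ... | no _    = refl

  label-twist : ∀ {m} (f : Fin n → Vec Bool m) z → label G (twist f) z ≡ label G f (swap z)
  label-twist f (inj₁ y) with y ≟ x
  ... | yes refl = sym (label-touching f pendant pendant-touches)
  ... | no _     = refl
  label-twist f (inj₂ e) with touches? G x e
  ... | inj₁ t = begin
    label G (twist f) (inj₂ e)  ≡⟨ label-touching (twist f) e t ⟩
    twist f x ⊕ twist f x′      ≡⟨ cong₂ _⊕_ (twist-leaf f) (twist-vertex f x′ x′≢x) ⟩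
    (f x ⊕ f x′) ⊕ f x′         ≡⟨ ⊕-cancelʳ (f x) (f x′) ⟩
    f x                         ∎
    where open ≡-Reasoning
  ... | inj₂ (i≢x , j≢x) = cong₂ _⊕_ (twist-vertex f _ i≢x) (twist-vertex f _ j≢x)

degree-one⇒leaf : ∀ {n} (G : Graph n) x → degree G x ≡ 1 →
  Σ (Fin n) λ x′ → Adj G x x′ × (∀ y → Adj G x y → y ≡ x′)
degree-one⇒leaf {n} G x = from-neighbours (filterᵇ (G x) (allFin n)) refl
  where
  from-neighbours : ∀ ys → filterᵇ (G x) (allFin n) ≡ ys → length ys ≡ 1 →
    Σ (Fin n) λ x′ → Adj G x x′ × (∀ y → Adj G x y → y ≡ x′)
  from-neighbours (x′ ∷ []) neighbours≡ _ = x′ , x~x′ , only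
    where
    x~x′ : Adj G x x′
    x~x′ = proj₂ (∈-filter⁻ (T? ∘ G x) {xs = allFin n} (subst (x′ ∈_) (sym neighbours≡) (here refl)))
    only : ∀ y → Adj G x y → y ≡ x′
    only y x~y with subst (y ∈_) neighbours≡ (∈-filter⁺ (T? ∘ G x) (∈-allFin y) x~y)
    ... | here y≡x′ = y≡x′
  from-neighbours [] _ ()
  from-neighbours (_ ∷ _ ∷ _) _ ()

third-vertex : ∀ {n} → 3 ≤ n → (u v : Fin n) → u ≢ v → Σ (Fin n) λ w → w ≢ u × w ≢ v
third-vertex (s≤s (s≤s (s≤s _))) u v u≢v =
  punchIn u w′ , punchInᵢ≢i u w′ , w≢v
  where
  v′ = punchOut u≢v
  w′ = punchIn v′ 0F
  w≢v : punchIn u w′ ≢ v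
  w≢v eq = punchInᵢ≢i v′ 0F (punchIn-injective u w′ v′ (trans eq (sym (punchIn-punchOut u≢v))))

-- In a connected simple graph with at least three vertices two distinct
-- leaves are not adjacent: otherwise no walk could leave {u, v}.
leaves-nonadjacent : ∀ {n} {G : Graph n} → IsSimpleGraph G → Connected G → 3 ≤ n →
  ∀ {u v u′ v′} → u ≢ v →
  (∀ y → Adj G u y → y ≡ u′) → (∀ y → Adj G v y → y ≡ v′) → ¬ Adj G u v
leaves-nonadjacent {G = G} simple connected n≥3 {u} {v} {u′} {v′} u≢v only-u only-v u~v =
  let (w , w≢u , w≢v) = third-vertex n≥3 u v u≢v
  in [ w≢u , w≢v ]′ (stays (connected u w) (inj₁ refl))
  where
  open SimpleGraph simple
  to-v : ∀ y → Adj G u y → y ≡ v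
  to-v y u~y = trans (only-u y u~y) (sym (only-u v u~v))
  to-u : ∀ y → Adj G v y → y ≡ u
  to-u y v~y = trans (only-v y v~y) (sym (only-v u (adj-sym u~v)))
  stays : ∀ {x y} → Walk G x y → x ≡ u ⊎ x ≡ v → y ≡ u ⊎ y ≡ v
  stays []                      x∈uv        = x∈uv
  stays (_∷_ {y = z} x~z walk)  (inj₁ refl) = stays walk (inj₂ (to-v z x~z))
  stays (_∷_ {y = z} x~z walk)  (inj₂ refl) = stays walk (inj₁ (to-u z x~z))

parity : ℕ → Bool
parity zero    = false
parity (suc k) = not (parity k)

parity-+ : ∀ a b → parity (a + b) ≡ parity a xor parity b
parity-+ zero    b = refl
parity-+ (suc a) b = trans (cong not (parity-+ a b)) (not-distribˡ-xor (parity a) (parity b))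

module Walks {n : ℕ} {G : Graph n} (simple : IsSimpleGraph G) where

  open SimpleGraph simple

  _++ʷ_ : ∀ {x y z} → Walk G x y → Walk G y z → Walk G x z
  []      ++ʷ q = q
  (e ∷ p) ++ʷ q = e ∷ (p ++ʷ q)

  reverseʷ : ∀ {x y} → Walk G x y → Walk G y x
  reverseʷ []      = []
  reverseʷ (e ∷ w) = reverseʷ w ++ʷ (adj-sym e ∷ [])

  len : ∀ {x y} → Walk G x y → ℕ
  len []      = 0
  len (_ ∷ w) = suc (len w)

  len-++ : ∀ {x y z} (p : Walk G x y) (q : Walk G y z) → len (p ++ʷ q) ≡ len p + len q
  len-++ []      q = refl
  len-++ (e ∷ p) q = cong suc (len-++ p q)

  len-reverse : ∀ {x y} (w : Walk G x y) → len (reverseʷ w) ≡ len w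
  len-reverse []      = refl
  len-reverse (e ∷ w) = begin
    len (reverseʷ w ++ʷ (adj-sym e ∷ []))  ≡⟨ len-++ (reverseʷ w) _ ⟩
    len (reverseʷ w) + 1                   ≡⟨ +-comm (len (reverseʷ w)) 1 ⟩
    suc (len (reverseʷ w))                 ≡⟨ cong suc (len-reverse w) ⟩
    suc (len w)                            ∎
    where open ≡-Reasoning

  -- the vertex list x₀, x₁, … of a walk, without its final vertex
  vertices : ∀ {x y} → Walk G x y → List (Fin n)
  vertices []            = []
  vertices (_∷_ {x} _ w) = x ∷ vertices w

  length-vertices : ∀ {x y} (w : Walk G x y) → length (vertices w) ≡ len w
  length-vertices []      = refl
  length-vertices (e ∷ w) = cong suc (length-vertices w)

  vertices-chain : ∀ {x y} (w : Walk G x y) → Chain G (vertices w ++ˡ y ∷ [])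
  vertices-chain []           = _
  vertices-chain (e ∷ [])     = e , _
  vertices-chain (e ∷ e′ ∷ w) = e , vertices-chain (e′ ∷ w)

module OddClosedWalks {n : ℕ} {G : Graph n} (simple : IsSimpleGraph G) (acyclic : ¬ HasCycle G) where

  open SimpleGraph simple
  open ≡-Reasoning
  open import Data.List.Membership.DecPropositional (Data.Fin._≟_ {n}) using (_∈?_)

  chain-split : ∀ xs y ys → Chain G (xs ++ˡ y ∷ ys) → Chain G (xs ++ˡ y ∷ []) × Chain G (y ∷ ys)
  chain-split []            y ys c       = _ , c
  chain-split (x ∷ [])      y ys (e , c) = (e , _) , c
  chain-split (x ∷ x′ ∷ xs) y ys (e , c) = let (c₁ , c₂) = chain-split (x′ ∷ xs) y ys c in (e , c₁) , c₂

  chain-join : ∀ xs y ys → Chain G (xs ++ˡ y ∷ []) → Chain G (y ∷ ys) → Chain G (xs ++ˡ y ∷ ys)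
  chain-join []            y ys _        c₂ = c₂
  chain-join (x ∷ [])      y ys (e , _)  c₂ = e , c₂
  chain-join (x ∷ x′ ∷ xs) y ys (e , c₁) c₂ = e , chain-join (x′ ∷ xs) y ys c₁ c₂

  -- x ∷ r is a closed walk x ~ r₁ ~ … ~ r_k ~ x, of length 1 + k
  Closed : Fin n → List (Fin n) → Set
  Closed x r = Chain G (x ∷ r ++ˡ x ∷ [])

  Repeats : List (Fin n) → Set
  Repeats xs = Σ (List (Fin n)) λ A → Σ (Fin n) λ a → Σ (List (Fin n)) λ B → Σ (List (Fin n)) λ C →
    xs ≡ A ++ˡ a ∷ B ++ˡ a ∷ C

  unique-or-repeats : ∀ xs → Unique xs ⊎ Repeats xs
  unique-or-repeats [] = inj₁ []
  unique-or-repeats (a ∷ xs) with a ∈? xs | unique-or-repeats xs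
  ... | yes a∈xs | _ = let (B , C , eq) = ∈-∃++ a∈xs in inj₂ ([] , a , B , C , cong (a ∷_) eq)
  ... | no a∉xs | inj₁ distinct = inj₁ (¬Any⇒All¬ xs a∉xs ∷ distinct)
  ... | no _ | inj₂ (A , b , B , C , eq) = inj₂ (a ∷ A , b , B , C , cong (a ∷_) eq)

  cut : ∀ {x r} A a B C → Closed x r → x ∷ r ≡ A ++ˡ a ∷ B ++ˡ a ∷ C →
    Closed a B × Σ (List (Fin n)) λ r′ → length r′ ≡ length C + length A × Closed a r′
  cut {x} A a B C closed eq = first , second A eq before
    where
    walk : Chain G (A ++ˡ a ∷ (B ++ˡ a ∷ (C ++ˡ x ∷ [])))
    walk = subst (Chain G) (begin
      (x ∷ _) ++ˡ x ∷ []                   ≡⟨ cong (_++ˡ x ∷ []) eq ⟩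
      (A ++ˡ a ∷ B ++ˡ a ∷ C) ++ˡ x ∷ []   ≡⟨ ++-assoc A (a ∷ B ++ˡ a ∷ C) (x ∷ []) ⟩
      A ++ˡ a ∷ (B ++ˡ a ∷ C) ++ˡ x ∷ []   ≡⟨ cong (λ t → A ++ˡ a ∷ t) (++-assoc B (a ∷ C) (x ∷ [])) ⟩
      A ++ˡ a ∷ B ++ˡ a ∷ C ++ˡ x ∷ []     ∎) closed
    before = proj₁ (chain-split A a _ walk)
    after  = proj₂ (chain-split A a _ walk)
    first : Closed a B
    first = proj₁ (chain-split (a ∷ B) a (C ++ˡ x ∷ []) after)
    rest : Chain G (a ∷ C ++ˡ x ∷ [])
    rest = proj₂ (chain-split (a ∷ B) a (C ++ˡ x ∷ []) after)
    -- the part after the second a, continued around through x and A back to a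
    second : ∀ A → x ∷ _ ≡ A ++ˡ a ∷ B ++ˡ a ∷ C → Chain G (A ++ˡ a ∷ []) →
      Σ (List (Fin n)) λ r′ → length r′ ≡ length C + length A × Closed a r′
    second []       refl _      = C , sym (+-identityʳ (length C)) , rest
    second (_ ∷ A′) refl before =
      C ++ˡ x ∷ A′ , length-++ C ,
      subst (λ t → Chain G (a ∷ t)) (sym (++-assoc C (x ∷ A′) (a ∷ [])))
        (chain-join (a ∷ C) x (A′ ++ˡ a ∷ []) rest before)

  -- if x ∷ r = A ++ a ∷ B ++ a ∷ C, the two pieces have lengths 1 + |B| and
  -- 1 + |C| + |A|, adding up to 1 + |r|
  cut-lengths : ∀ r a b c → suc r ≡ a + suc (b + suc c) → r ≡ b + suc (c + a)
  cut-lengths r a b c eq = suc-injective (trans eq (rearrange a b c))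
    where
    rearrange : ∀ a b c → a + suc (b + suc c) ≡ suc (b + suc (c + a))
    rearrange = solve-∀

  -- a closed walk without repetitions of odd length (so of length ≥ 3) is a cycle
  odd-distinct-cycle : ∀ x r → Unique (x ∷ r) → Closed x r → parity (suc (length r)) ≡ true → HasCycle G
  odd-distinct-cycle x []          _        (x~x , _) _  = ⊥-elim (adj-irrefl x~x)
  odd-distinct-cycle x (y ∷ [])    _        _         ()
  odd-distinct-cycle x (y ∷ z ∷ r) distinct closed    _  = x , y ∷ z ∷ r , s≤s (s≤s z≤n) , distinct , closed

  -- by strong induction on the length: an odd closed walk with a repeated
  -- vertex splits into two closed walks, one of them odd and shorter
  no-odd-closed : ∀ N x r → length r < N → Closed x r → parity (suc (length r)) ≢ true
  no-odd-closed (suc N) x r (s≤s r≤N) closed odd with unique-or-repeats (x ∷ r)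
  ... | inj₁ distinct = acyclic (odd-distinct-cycle x r distinct closed odd)
  ... | inj₂ (A , a , B , C , eq) with cut A a B C closed eq
  ...   | closed₁ , r′ , len-r′ , closed₂
    with lengths ← cut-lengths (length r) (length A) (length B) (length C) (begin
           suc (length r)                              ≡⟨ cong length eq ⟩
           length (A ++ˡ a ∷ B ++ˡ a ∷ C)              ≡⟨ length-++ A ⟩
           length A + suc (length (B ++ˡ a ∷ C))       ≡⟨ cong (λ t → length A + suc t) (length-++ B) ⟩
           length A + suc (length B + suc (length C))  ∎)
    with parity (suc (length B)) in odd₁ | parity (suc (length r′)) in odd₂
  ... | true  | _    = no-odd-closed N a B shorter₁ closed₁ odd₁
    where
    shorter₁ : length B < N
    shorter₁ = ≤-trans (subst (length B <_) (sym lengths) (m<m+n (length B) (s≤s z≤n))) r≤N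
  ... | false | true = no-odd-closed N a r′ shorter₂ closed₂ odd₂
    where
    shorter₂ : length r′ < N
    shorter₂ = ≤-trans (subst₂ _<_ (sym len-r′) (sym lengths) (m≤n+m (suc (length C + length A)) (length B))) r≤N
  ... | false | false = false≢true (begin
    false                                                       ≡⟨ cong₂ _xor_ (sym odd₁) (sym odd₂) ⟩
    parity (suc (length B)) xor parity (suc (length r′))        ≡⟨ sym (parity-+ (suc (length B)) (suc (length r′))) ⟩
    parity (suc (length B) + suc (length r′))                   ≡⟨ cong (λ t → parity (suc (length B + suc t))) len-r′ ⟩
    parity (suc (length B + suc (length C + length A)))         ≡⟨ cong (parity ∘ suc) (sym lengths) ⟩
    parity (suc (length r))                                     ≡⟨ odd ⟩
    true                                                        ∎)
    where
    false≢true : false ≢ true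
    false≢true ()

  open Walks simple

  no-odd-closed-walk : ∀ {x} (w : Walk G x x) → parity (len w) ≢ true
  no-odd-closed-walk []          ()
  no-odd-closed-walk {x} (e ∷ w) odd =
    no-odd-closed _ x (vertices w) ≤-refl (vertices-chain (e ∷ w))
      (subst (λ k → parity (suc k) ≡ true) (sym (length-vertices w)) odd)

-- A tree is properly 2-coloured by the parity of the length of a walk from
-- a fixed root: an edge inside one colour class would close an odd walk.
two-colouring : ∀ {n} {G : Graph n} → IsTree G → (root : Fin n) →
  Σ (Fin n → Bool) λ colour → colour root ≡ false × (∀ {x y} → Adj G x y → colour x ≢ colour y)
two-colouring {G = G} (simple , connected , acyclic) root = colour , colour-root , proper
  where
  open SimpleGraph simple
  open Walks simple
  open OddClosedWalks simple acyclic

  colour : _ → Bool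
  colour y = parity (len (connected root y))

  colour-root : colour root ≡ false
  colour-root with colour root in even
  ... | false = refl
  ... | true  = ⊥-elim (no-odd-closed-walk (connected root root) even)

  proper : ∀ {x y} → Adj G x y → colour x ≢ colour y
  proper {x} {y} x~y same = no-odd-closed-walk cycle (begin
    parity (len cycle)                                 ≡⟨ cong parity length-cycle ⟩
    parity (len (path x) + (len (path y) + 1))             ≡⟨ parity-+ (len (path x)) _ ⟩
    colour x xor parity (len (path y) + 1)               ≡⟨ cong (colour x xor_) (parity-+ (len (path y)) 1) ⟩
    colour x xor (colour y xor true)                   ≡⟨ cong (λ c → colour x xor (c xor true)) (sym same) ⟩
    colour x xor (colour x xor true)                   ≡⟨ sym (xor-assoc (colour x) (colour x) true) ⟩
    (colour x xor colour x) xor true                   ≡⟨ cong (_xor true) (xor-same (colour x)) ⟩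
    true                                               ∎)
    where
    open ≡-Reasoning
    path : ∀ z → Walk G root z
    path = connected root
    cycle : Walk G x x
    cycle = reverseʷ (path x) ++ʷ (path y ++ʷ (adj-sym x~y ∷ []))
    length-cycle : len cycle ≡ len (path x) + (len (path y) + 1)
    length-cycle = trans (len-++ (reverseʷ (path x)) _) (cong₂ _+_ (len-reverse (path x)) (len-++ (path y) _))

-- The tree T′ = fourCopies G u v.  Vertex x of copy k is combine k x; its
-- items are the four copies of the items of G together with three bridges.
module FourCopies {n : ℕ} (G : Graph n) (u v : Fin n) where

  open Data.Fin using (_≟_)

  G′ : Graph (4 * n)
  G′ = fourCopies G u v

  vertex : Fin 4 → Fin n → Fin (4 * n)
  vertex = combine

  is : Fin 4 → Fin n → Fin 4 → Fin n → Bool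
  is k x k₀ x₀ = ⌊ k ≟ k₀ ⌋ ∧ ⌊ x ≟ x₀ ⌋

  bridgeAdj : Fin 4 → Fin n → Fin 4 → Fin n → Bool
  bridgeAdj k x l y =
    (is k x 0F u ∧ is l y 1F u) ∨ (is k x 1F v ∧ is l y 2F v) ∨ (is k x 2F u ∧ is l y 3F u)

  copiesAdj : Fin 4 × Fin n → Fin 4 × Fin n → Bool
  copiesAdj (k , x) (l , y) = (⌊ k ≟ l ⌋ ∧ G x y) ∨ bridgeAdj k x l y ∨ bridgeAdj l y k x

  vertexᵖ : Fin 4 × Fin n → Fin (4 * n)
  vertexᵖ (k , x) = vertex k x

  adj-vertex : ∀ p q → T (copiesAdj p q) → Adj G′ (vertexᵖ p) (vertexᵖ q)
  adj-vertex (k , x) (l , y) =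
    subst T (sym (cong₂ copiesAdj (remQuot-combine {4} {n} k x) (remQuot-combine {4} {n} l y)))

  ⌊≟⌋-refl : ∀ {N} (x : Fin N) → ⌊ x ≟ x ⌋ ≡ true
  ⌊≟⌋-refl x = cong ⌊_⌋ (≡-≟-identity _≟_ {x} refl)

  vertex-<⁺ : ∀ k {x y} → x <ᶠ y → vertex k x <ᶠ vertex k y
  vertex-<⁺ k {x} {y} x<y =
    subst₂ _<_ (sym (toℕ-combine k x)) (sym (toℕ-combine k y)) (+-monoʳ-< (n * toℕ k) x<y)

  vertex-<⁻ : ∀ k {x y} → vertex k x <ᶠ vertex k y → x <ᶠ y
  vertex-<⁻ k {x} {y} lt =
    +-cancelˡ-< (n * toℕ k) (toℕ x) (toℕ y) (subst₂ _<_ (toℕ-combine k x) (toℕ-combine k y) lt)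

  copy-edge : Fin 4 → Edge G → Edge G′
  copy-edge k ((x , y) , x<y , x~y) =
    (vertex k x , vertex k y) , vertex-<⁺ k x<y , adj-vertex (k , x) (k , y) inside
    where
    inside : T (copiesAdj (k , x) (k , y))
    inside rewrite ⌊≟⌋-refl k = from (T-∨ {G x y}) (inj₁ x~y)

  bridge-start bridge-end : Fin 3 → Fin 4 × Fin n
  bridge-start 0F = 0F , u
  bridge-start 1F = 1F , v
  bridge-start 2F = 2F , u
  bridge-end 0F = 1F , u
  bridge-end 1F = 2F , v
  bridge-end 2F = 3F , u

  bridge-< : ∀ b → vertexᵖ (bridge-start b) <ᶠ vertexᵖ (bridge-end b)
  bridge-< 0F = combine-monoˡ-< {m = 4} {i = 0F} {j = 1F} u u (s≤s z≤n)
  bridge-< 1F = combine-monoˡ-< {m = 4} {i = 1F} {j = 2F} v v (s≤s (s≤s z≤n))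
  bridge-< 2F = combine-monoˡ-< {m = 4} {i = 2F} {j = 3F} u u (s≤s (s≤s (s≤s z≤n)))

  is⇒≡ : ∀ k x k₀ x₀ → T (is k x k₀ x₀) → (k , x) ≡ (k₀ , x₀)
  is⇒≡ k x k₀ x₀ t = let (k≡ , x≡) = to T-∧ t in cong₂ _,_ (toWitness {a? = k ≟ k₀} k≡) (toWitness {a? = x ≟ x₀} x≡)

  bridge-adj : ∀ b → T (copiesAdj (bridge-start b) (bridge-end b))
  bridge-adj 0F rewrite ⌊≟⌋-refl u = _
  bridge-adj 1F rewrite ⌊≟⌋-refl v = _
  bridge-adj 2F rewrite ⌊≟⌋-refl u = _

  bridgeAdj⇒bridge : ∀ k x l y → T (bridgeAdj k x l y) →
    Σ (Fin 3) λ b → (k , x) ≡ bridge-start b × (l , y) ≡ bridge-end b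
  bridgeAdj⇒bridge k x l y t with to T-∨ t
  ... | inj₁ t₀ = let (s , e) = to T-∧ t₀ in 0F , is⇒≡ k x 0F u s , is⇒≡ l y 1F u e
  ... | inj₂ t₁₂ with to T-∨ t₁₂
  ...   | inj₁ t₁ = let (s , e) = to T-∧ t₁ in 1F , is⇒≡ k x 1F v s , is⇒≡ l y 2F v e
  ...   | inj₂ t₂ = let (s , e) = to T-∧ t₂ in 2F , is⇒≡ k x 2F u s , is⇒≡ l y 3F u e

  bridge : Fin 3 → Edge G′
  bridge b = (vertexᵖ (bridge-start b) , vertexᵖ (bridge-end b)) , bridge-< b ,
    adj-vertex (bridge-start b) (bridge-end b) (bridge-adj b)

  Index : Set
  Index = (Fin 4 × Item G) ⊎ Fin 3

  enc : Index → Item G′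
  enc (inj₁ (k , inj₁ x)) = inj₁ (vertex k x)
  enc (inj₁ (k , inj₂ e)) = inj₂ (copy-edge k e)
  enc (inj₂ b)            = inj₂ (bridge b)

  -- an edge between vertex k x and vertex l y lies inside a copy (k = l) or
  -- is a bridge; a bridge read backwards would violate the order of endpoints
  edge-onto : ∀ p q {a b} → vertexᵖ p ≡ a → vertexᵖ q ≡ b → (lt : a <ᶠ b) (adj : Adj G′ a b) →
    T (copiesAdj p q) → Σ Index λ d → enc d ≡ inj₂ ((a , b) , lt , adj)
  edge-onto (k , x) (l , y) refl refl lt adj t with to T-∨ t
  ... | inj₁ inside with to T-∧ inside
  ...   | k≡l , x~y with refl ← toWitness {a? = k ≟ l} k≡l =
    inj₁ (k , inj₂ ((x , y) , vertex-<⁻ k lt , x~y)) , cong inj₂ (edge-≡ G′ _ _ refl)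
  edge-onto (k , x) (l , y) refl refl lt adj t | inj₂ t′ with to T-∨ t′
  ...   | inj₁ forward with bridgeAdj⇒bridge k x l y forward
  ...     | b , refl , refl = inj₂ b , cong inj₂ (edge-≡ G′ _ _ refl)
  edge-onto (k , x) (l , y) refl refl lt adj t | inj₂ t′ | inj₂ backward with bridgeAdj⇒bridge l y k x backward
  ...     | b , refl , refl = ⊥-elim (Data.Fin.Properties.<-asym lt (bridge-< b))

  enc-onto : ∀ z → Σ Index λ d → enc d ≡ z
  enc-onto (inj₁ a) =
    inj₁ (proj₁ (remQuot {4} n a) , inj₁ (proj₂ (remQuot {4} n a))) , cong inj₁ (combine-remQuot {4} n a)
  enc-onto (inj₂ ((a , b) , lt , adj)) =
    edge-onto (remQuot {4} n a) (remQuot {4} n b) (combine-remQuot {4} n a) (combine-remQuot {4} n b) lt adj adj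

  glue : ∀ {m} → (Fin 4 → Fin n → Vec Bool m) → Fin (4 * n) → Vec Bool m
  glue h a = h (proj₁ (remQuot {4} n a)) (proj₂ (remQuot {4} n a))

  glue-vertex : ∀ {m} (h : Fin 4 → Fin n → Vec Bool m) k x → glue h (vertex k x) ≡ h k x
  glue-vertex h k x = cong (λ p → h (proj₁ p) (proj₂ p)) (remQuot-combine {4} {n} k x)

  label-copy : ∀ {m} (h : Fin 4 → Fin n → Vec Bool m) k z → label G′ (glue h) (enc (inj₁ (k , z))) ≡ label G (h k) z
  label-copy h k (inj₁ x)              = glue-vertex h k x
  label-copy h k (inj₂ ((x , y) , _))  = cong₂ _⊕_ (glue-vertex h k x) (glue-vertex h k y)

  label-bridge : ∀ {m} (h : Fin 4 → Fin n → Vec Bool m) b →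
    let (k , x) = bridge-start b ; (l , y) = bridge-end b in
    label G′ (glue h) (enc (inj₂ b)) ≡ h k x ⊕ h l y
  label-bridge h b = cong₂ _⊕_ (glue-vertex h _ _) (glue-vertex h _ _)

-- Let f label the tree G in 𝔽₂^m, let u, v be
-- non-adjacent leaves with neighbours u′, v′, and let colour be a proper
-- 2-colouring with colour u′ = false.  Vertex x of copy k is labelled
-- high k x ++ low k x ∈ 𝔽₂^(2+m): low k is f on copies 0, 1 and the
-- u-twist of f on copies 2, 3, so copy k relabels items by σ k; high is
-- chosen so that the copy of σ k y in copy k gets ⟦ π y ⟧ k on top of the
-- label of y, i.e. the four copies of y receive the four elements of 𝔽₂².
module Construction {n : ℕ} {G : Graph n} (simple : IsSimpleGraph G) {m : ℕ} (f : Fin n → Vec Bool m)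
  {u v u′ v′ : Fin n} (u≢v : u ≢ v)
  (u~u′ : Adj G u u′) (only-u : ∀ y → Adj G u y → y ≡ u′)
  (v~v′ : Adj G v v′) (only-v : ∀ y → Adj G v y → y ≡ v′) (u≁v : ¬ Adj G u v)
  (colour : Fin n → Bool) (proper : ∀ {x y} → Adj G x y → colour x ≢ colour y) (colour-u′ : colour u′ ≡ false)
  where

  open SimpleGraph simple
  open Data.Fin using (_≟_)
  module U = Leaf simple u~u′ only-u
  module V = Leaf simple v~v′ only-v
  open FourCopies G u v
  open ≡-Reasoning

  v≢u : v ≢ u
  v≢u = u≢v ∘ sym

  u′≢v : u′ ≢ v
  u′≢v refl = u≁v u~u′

  v′≢u : v′ ≢ u
  v′≢u refl = u≁v (adj-sym v~v′)

  σ : Fin 4 → Item G → Item G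
  σ 0F = id
  σ 1F = id
  σ 2F = U.swap
  σ 3F = U.swap

  σ-involutive : ∀ k z → σ k (σ k z) ≡ z
  σ-involutive 0F z = refl
  σ-involutive 1F z = refl
  σ-involutive 2F z = U.swap-involutive z
  σ-involutive 3F z = U.swap-involutive z

  σ-vertex : ∀ k y → y ≢ u → σ k (inj₁ y) ≡ inj₁ y
  σ-vertex 0F y _   = refl
  σ-vertex 1F y _   = refl
  σ-vertex 2F y y≢u = U.swap-vertex y y≢u
  σ-vertex 3F y y≢u = U.swap-vertex y y≢u

  σ-avoiding : ∀ k e → Avoids G u e → σ k (inj₂ e) ≡ inj₂ e
  σ-avoiding 0F e _ = refl
  σ-avoiding 1F e _ = refl
  σ-avoiding 2F e a = U.swap-avoiding e a
  σ-avoiding 3F e a = U.swap-avoiding e a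

  low : Fin 4 → Fin n → Vec Bool m
  low 0F = f
  low 1F = f
  low 2F = U.twist f
  low 3F = U.twist f

  label-low : ∀ k z → label G (low k) z ≡ label G f (σ k z)
  label-low 0F z = refl
  label-low 1F z = refl
  label-low 2F z = U.label-twist f z
  label-low 3F z = U.label-twist f z

  π : Item G → Numbering
  π (inj₁ x) with x ≟ u | x ≟ v
  ... | yes _ | _     = ν₂
  ... | no _  | yes _ = ν₂
  ... | no _  | no _  = byColour (colour x)
  π (inj₂ e) with touches? G u e | touches? G v e
  ... | inj₁ _ | _      = ν₁
  ... | inj₂ _ | inj₁ _ = byColour (not (colour v′))
  ... | inj₂ _ | inj₂ _ = ν₂

  π-u : π (inj₁ u) ≡ ν₂
  π-u with u ≟ u
  ... | yes _  = refl
  ... | no u≢u = ⊥-elim (u≢u refl)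

  π-v : π (inj₁ v) ≡ ν₂
  π-v with v ≟ u | v ≟ v
  ... | yes _ | _      = refl
  ... | no _  | yes _  = refl
  ... | no _  | no v≢v = ⊥-elim (v≢v refl)

  π-inner : ∀ x → x ≢ u → x ≢ v → π (inj₁ x) ≡ byColour (colour x)
  π-inner x x≢u x≢v with x ≟ u | x ≟ v
  ... | yes x≡u | _       = ⊥-elim (x≢u x≡u)
  ... | no _    | yes x≡v = ⊥-elim (x≢v x≡v)
  ... | no _    | no _    = refl

  π-at-u : ∀ e → Touches G u e → π (inj₂ e) ≡ ν₁
  π-at-u e t with touches? G u e
  ... | inj₁ _           = refl
  ... | inj₂ (i≢u , j≢u) = ⊥-elim ([ i≢u , j≢u ]′ t)

  π-at-v : ∀ e → Avoids G u e → Touches G v e → π (inj₂ e) ≡ byColour (not (colour v′))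
  π-at-v e (i≢u , j≢u) t with touches? G u e | touches? G v e
  ... | inj₁ t′ | _                = ⊥-elim ([ i≢u , j≢u ]′ t′)
  ... | inj₂ _  | inj₁ _           = refl
  ... | inj₂ _  | inj₂ (i≢v , j≢v) = ⊥-elim ([ i≢v , j≢v ]′ t)

  π-inner-edge : ∀ e → Avoids G u e → Avoids G v e → π (inj₂ e) ≡ ν₂
  π-inner-edge e (i≢u , j≢u) (i≢v , j≢v) with touches? G u e | touches? G v e
  ... | inj₁ t | _      = ⊥-elim ([ i≢u , j≢u ]′ t)
  ... | inj₂ _ | inj₁ t = ⊥-elim ([ i≢v , j≢v ]′ t)
  ... | inj₂ _ | inj₂ _ = refl

  -- defined so that the claim below holds for vertices by construction
  high : Fin 4 → Fin n → 𝔽₂²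
  high k x = ⟦ π (σ k (inj₁ x)) ⟧ k

  high-fixed : ∀ k x → x ≢ u → high k x ≡ ⟦ π (inj₁ x) ⟧ k
  high-fixed k x x≢u = cong (λ z → ⟦ π z ⟧ k) (σ-vertex k x x≢u)

  -- an edge away from u: the endpoint numberings of the edge at v are ν₂
  -- and that of the colour of v′; otherwise they are those of the two colours
  label-high-away : ∀ k e → Avoids G u e → label G (high k) (inj₂ e) ≡ ⟦ π (inj₂ e) ⟧ k
  label-high-away k e@((i , j) , _ , i~j) away@(i≢u , j≢u) = [ at-v , inner ]′ (touches? G v e)
    where
    at-v : Touches G v e → high k i ⊕ high k j ≡ ⟦ π (inj₂ e) ⟧ k
    at-v t = begin
      high k i ⊕ high k j                      ≡⟨ V.label-touching (high k) e t ⟩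
      high k v ⊕ high k v′                     ≡⟨ cong₂ _⊕_ (high-fixed k v v≢u) (high-fixed k v′ v′≢u) ⟩
      ⟦ π (inj₁ v) ⟧ k ⊕ ⟦ π (inj₁ v′) ⟧ k     ≡⟨ cong₂ (λ a b → ⟦ a ⟧ k ⊕ ⟦ b ⟧ k) π-v (π-inner v′ v′≢u V.x′≢x) ⟩
      ⟦ ν₂ ⟧ k ⊕ ⟦ byColour (colour v′) ⟧ k     ≡⟨ ν₂-shift (colour v′) k ⟩
      ⟦ byColour (not (colour v′)) ⟧ k         ≡⟨ cong (λ a → ⟦ a ⟧ k) (π-at-v e away t) ⟨
      ⟦ π (inj₂ e) ⟧ k                         ∎
    inner : Avoids G v e → high k i ⊕ high k j ≡ ⟦ π (inj₂ e) ⟧ k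
    inner (i≢v , j≢v) = begin
      high k i ⊕ high k j                                        ≡⟨ cong₂ _⊕_ (high-fixed k i i≢u) (high-fixed k j j≢u) ⟩
      ⟦ π (inj₁ i) ⟧ k ⊕ ⟦ π (inj₁ j) ⟧ k                        ≡⟨ cong₂ (λ a b → ⟦ a ⟧ k ⊕ ⟦ b ⟧ k) (π-inner i i≢u i≢v) (π-inner j j≢u j≢v) ⟩
      ⟦ byColour (colour i) ⟧ k ⊕ ⟦ byColour (colour j) ⟧ k      ≡⟨ cong (λ c → ⟦ byColour (colour i) ⟧ k ⊕ ⟦ byColour c ⟧ k) (¬-not (proper (adj-sym i~j))) ⟩
      ⟦ byColour (colour i) ⟧ k ⊕ ⟦ byColour (not (colour i)) ⟧ k ≡⟨ colours-sum (colour i) k ⟩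
      ⟦ ν₂ ⟧ k                                                   ≡⟨ cong (λ a → ⟦ a ⟧ k) (π-inner-edge e away (i≢v , j≢v)) ⟨
      ⟦ π (inj₂ e) ⟧ k                                           ∎

  -- the pendant edge at u: its endpoints carry ν₂ or ν₁ (copies 0, 1 resp.
  -- 2, 3, where u has taken the place of the pendant edge) and ν₀
  label-high-pendant : ∀ k → label G (high k) (inj₂ U.pendant) ≡ ⟦ π (σ k (inj₂ U.pendant)) ⟧ k
  label-high-pendant k = begin
    label G (high k) (inj₂ U.pendant)    ≡⟨ U.label-touching (high k) U.pendant U.pendant-touches ⟩
    high k u ⊕ high k u′                 ≡⟨ cong (high k u ⊕_) high-u′ ⟩
    high k u ⊕ ⟦ ν₀ ⟧ k                  ≡⟨ by-copy k ⟩
    ⟦ π (σ k (inj₂ U.pendant)) ⟧ k       ∎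
    where
    high-u′ : high k u′ ≡ ⟦ ν₀ ⟧ k
    high-u′ = trans (high-fixed k u′ U.x′≢x)
      (cong (λ a → ⟦ a ⟧ k) (trans (π-inner u′ U.x′≢x u′≢v) (cong byColour colour-u′)))
    untwisted : ∀ k → σ k ≡ id → high k u ⊕ ⟦ ν₀ ⟧ k ≡ ⟦ π (σ k (inj₂ U.pendant)) ⟧ k
    untwisted k σk≡id rewrite σk≡id = begin
      ⟦ π (inj₁ u) ⟧ k ⊕ ⟦ ν₀ ⟧ k       ≡⟨ cong (λ a → ⟦ a ⟧ k ⊕ ⟦ ν₀ ⟧ k) π-u ⟩
      ⟦ ν₂ ⟧ k ⊕ ⟦ byColour false ⟧ k   ≡⟨ ν₂-shift false k ⟩
      ⟦ ν₁ ⟧ k                          ≡⟨ cong (λ a → ⟦ a ⟧ k) (π-at-u U.pendant U.pendant-touches) ⟨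
      ⟦ π (inj₂ U.pendant) ⟧ k          ∎
    twisted : ∀ k → σ k ≡ U.swap → high k u ⊕ ⟦ ν₀ ⟧ k ≡ ⟦ π (σ k (inj₂ U.pendant)) ⟧ k
    twisted k σk≡swap rewrite σk≡swap = begin
      ⟦ π (U.swap (inj₁ u)) ⟧ k ⊕ ⟦ ν₀ ⟧ k   ≡⟨ cong (λ a → ⟦ π a ⟧ k ⊕ ⟦ ν₀ ⟧ k) U.swap-leaf ⟩
      ⟦ π (inj₂ U.pendant) ⟧ k ⊕ ⟦ ν₀ ⟧ k     ≡⟨ cong (λ a → ⟦ a ⟧ k ⊕ ⟦ ν₀ ⟧ k) (π-at-u U.pendant U.pendant-touches) ⟩
      ⟦ byColour true ⟧ k ⊕ ⟦ ν₀ ⟧ k          ≡⟨ colours-sum true k ⟩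
      ⟦ ν₂ ⟧ k                                ≡⟨ cong (λ a → ⟦ a ⟧ k) π-u ⟨
      ⟦ π (inj₁ u) ⟧ k                        ≡⟨ cong (λ a → ⟦ π a ⟧ k) (U.swap-touching U.pendant U.pendant-touches) ⟨
      ⟦ π (U.swap (inj₂ U.pendant)) ⟧ k       ∎
    by-copy : ∀ k → high k u ⊕ ⟦ ν₀ ⟧ k ≡ ⟦ π (σ k (inj₂ U.pendant)) ⟧ k
    by-copy 0F = untwisted 0F refl
    by-copy 1F = untwisted 1F refl
    by-copy 2F = twisted 2F refl
    by-copy 3F = twisted 3F refl

  label-high : ∀ k z → label G (high k) z ≡ ⟦ π (σ k z) ⟧ k
  label-high k (inj₁ x) = refl
  label-high k (inj₂ e) with touches? G u e
  ... | inj₁ t with refl ← U.touching-unique e U.pendant t U.pendant-touches = label-high-pendant k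
  ... | inj₂ a = trans (label-high-away k e a) (cong (λ z → ⟦ π z ⟧ k) (sym (σ-avoiding k e a)))

  copyLabel : Fin 4 → Fin n → Vec Bool (2 + m)
  copyLabel k x = high k x ++ low k x

  label-copyLabel : ∀ k z → label G (copyLabel k) z ≡ label G (high k) z ++ label G (low k) z
  label-copyLabel k (inj₁ x)             = refl
  label-copyLabel k (inj₂ ((x , y) , _)) = ⊕-++ (high k x) (high k y) (low k x) (low k y)

  label-copy-σ : ∀ k y → label G (copyLabel k) (σ k y) ≡ stack (label G f) nonzero₂ π (inj₁ (k , y))
  label-copy-σ k y = begin
    label G (copyLabel k) (σ k y)                                  ≡⟨ label-copyLabel k (σ k y) ⟩
    label G (high k) (σ k y) ++ label G (low k) (σ k y)            ≡⟨ cong₂ _++_ (label-high k (σ k y)) (label-low k (σ k y)) ⟩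
    ⟦ π (σ k (σ k y)) ⟧ k ++ label G f (σ k (σ k y))               ≡⟨ cong (λ z → ⟦ π z ⟧ k ++ label G f z) (σ-involutive k y) ⟩
    ⟦ π y ⟧ k ++ label G f y                                       ∎

  bridge-high : ∀ b → let (k , x) = bridge-start b ; (l , y) = bridge-end b in high k x ⊕ high l y ≡ nonzero₂ b
  bridge-high 0F = cong₂ (λ a a′ → ⟦ a ⟧ 0F ⊕ ⟦ a′ ⟧ 1F) π-u π-u
  bridge-high 1F = cong₂ (λ a a′ → ⟦ a ⟧ 1F ⊕ ⟦ a′ ⟧ 2F) π-v (trans (cong π (U.swap-vertex v v≢u)) π-v)
  bridge-high 2F = cong₂ (λ a a′ → ⟦ a ⟧ 2F ⊕ ⟦ a′ ⟧ 3F) π-pendant π-pendant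
    where
    π-pendant : π (U.swap (inj₁ u)) ≡ ν₁
    π-pendant = trans (cong π U.swap-leaf) (π-at-u U.pendant U.pendant-touches)

  bridge-low : ∀ b → let (k , x) = bridge-start b ; (l , y) = bridge-end b in low k x ⊕ low l y ≡ 𝟎
  bridge-low 0F = ⊕-self (f u)
  bridge-low 1F = trans (cong (f v ⊕_) (U.twist-vertex f v v≢u)) (⊕-self (f v))
  bridge-low 2F = ⊕-self (U.twist f u)

  label-bridge-stack : ∀ b → let (k , x) = bridge-start b ; (l , y) = bridge-end b in
    copyLabel k x ⊕ copyLabel l y ≡ stack (label G f) nonzero₂ π (inj₂ b)
  label-bridge-stack b =
    trans (⊕-++ (high k x) (high l y) (low k x) (low l y)) (cong₂ _++_ (bridge-high b) (bridge-low b))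
    where
    k = proj₁ (bridge-start b)
    x = proj₂ (bridge-start b)
    l = proj₁ (bridge-end b)
    y = proj₂ (bridge-end b)

  g : Fin (4 * n) → Vec Bool (2 + m)
  g = glue copyLabel

  listing : Index → Item G′
  listing (inj₁ (k , y)) = enc (inj₁ (k , σ k y))
  listing (inj₂ b)       = enc (inj₂ b)

  listing-onto : ∀ z → Σ Index λ d → listing d ≡ z
  listing-onto z with enc-onto z
  ... | inj₁ (k , y) , refl = inj₁ (k , σ k y) , cong (λ y′ → enc (inj₁ (k , y′))) (σ-involutive k y)
  ... | inj₂ b , refl       = inj₂ b , refl

  label-listing : ∀ d → label G′ g (listing d) ≡ stack (label G f) nonzero₂ π d
  label-listing (inj₁ (k , y)) = trans (label-copy copyLabel k (σ k y)) (label-copy-σ k y)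
  label-listing (inj₂ b)       = trans (label-bridge copyLabel b) (label-bridge-stack b)

  labelling : IsSetSequentialLabelling G f → IsSetSequentialLabelling G′ g
  labelling f-set-sequential =
    bijection⇒labelling G′ listing (stack (label G f) nonzero₂ π) listing-onto label-listing
      (stack-bijection (labelling⇒bijection G f-set-sequential) nonzero₂-bijection π)

theorem17 : ∀ (n : ℕ) (T : Graph n) → IsTree T → SetSequential T → 3 ≤ n →
    (u v : Fin n) → u ≢ v → degree T u ≡ 1 → degree T v ≡ 1 →
    SetSequential (fourCopies T u v)
theorem17 n G tree@(simple , connected , _) (m , _ , f , f-set-sequential) n≥3 u v u≢v deg-u deg-v
  with degree-one⇒leaf G u deg-u | degree-one⇒leaf G v deg-v
... | u′ , u~u′ , only-u | v′ , v~v′ , only-v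
  with two-colouring tree u′
... | colour , colour-u′ , proper = 2 + m , s≤s z≤n , C.g , C.labelling f-set-sequential
  where
  u≁v : ¬ Adj G u v
  u≁v = leaves-nonadjacent simple connected n≥3 u≢v only-u only-v
  module C = Construction simple f u≢v u~u′ only-u v~v′ only-v u≁v colour proper colour-u′
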